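{- Let $G$ be a graph and let $S\subseteq V(G)$ be an irredundant set. Then for every twin class $T$ of $G$, either $T\cap S=\emptyset$ or $T\subseteq S$.
   Context: For $S\subseteq V(G)$, a vertex $v\in S$ is redundant if at most one connected component of $G-S$ contains a neighbor of $v$; $S$ is irredundant if it contains no redundant vertex. Two vertices $u,v$ are twins if $N(u)\setminus\{v\}=N(v)\setminus\{u\}$, where $N(\cdot)$ is the open neighborhood. A twin class is a maximal set of pairwise twin vertices. -}

module Defs where

open import Data.Nat using (ℕ)
open import Data.Fin using (Fin)
open import Data.Fin.Subset using (Subset; _∈_; _∉_)
open import Data.Bool using (Bool; true; false)
open import Relation.Binary.PropositionalEquality using (_≡_)
open import Relation.Nullary using (¬_)
open import Data.Product using (∃; _×_; _,_)

record Graph (n : ℕ) : Set where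
  field
    adj   : Fin n → Fin n → Bool
    sym   : ∀ u v → adj u v ≡ adj v u
    irrefl : ∀ v → adj v v ≡ false

open Graph public

module _ {n : ℕ} (G : Graph n) where

  Adj : Fin n → Fin n → Set
  Adj u v = adj G u v ≡ true

  -- u and v lie in the same connected component of G - S
  -- (both outside S, joined by a walk all of whose vertices lie outside S)
  data Conn (S : Subset n) : Fin n → Fin n → Set where
    here : ∀ {u} → u ∉ S → Conn S u u
    step : ∀ {u w v} → u ∉ S → Adj u w → Conn S w v → Conn S u v

  -- v ∈ S is redundant: at most one component of G - S contains a
  -- neighbour of v, i.e. any two neighbours of v outside S lie in the
  -- same component of G - S
  Redundant : Subset n → Fin n → Set
  Redundant S v =
    v ∈ S × (∀ a b → Adj v a → a ∉ S → Adj v b → b ∉ S → Conn S a b)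

  Irredundant : Subset n → Set
  Irredundant S = ∀ v → v ∈ S → ¬ Redundant S v

  Twins : Fin n → Fin n → Set
  Twins u v = ∀ w → ¬ w ≡ u → ¬ w ≡ v → (Adj u w → Adj v w) × (Adj v w → Adj u w)

  TwinClass : Subset n → Set
  TwinClass T =
    (∀ u v → u ∈ T → v ∈ T → Twins u v) ×
    (∀ w → (∀ u → u ∈ T → Twins w u) → w ∈ T)

{-# OPTIONS --safe #-}
module Submission where

-- If u ∈ S and its twin v ∉ S, then every neighbour of u outside S other
-- than v is also a neighbour of v, so all these neighbours lie in the
-- component of G - S containing v, and u is redundant.

open import Defs
open import Data.Nat using (ℕ)
open import Data.Fin using (Fin; _≟_)
open import Data.Fin.Subset using (Subset; _∩_; _⊆_; Empty; _∈_; _∉_)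
open import Data.Fin.Subset.Properties using (_∈?_; x∈p∩q⁻)
open import Data.Fin.Properties using (any?)
open import Data.Sum using (_⊎_; inj₁; inj₂)
open import Data.Product using (_,_; proj₁)
open import Relation.Nullary using (yes; no)
open import Relation.Nullary.Decidable using (decidable-stable)
open import Relation.Binary.PropositionalEquality using (_≢_; refl; trans)

module _ {n : ℕ} (G : Graph n) where

  Adj-sym : ∀ {u v} → Adj G u v → Adj G v u
  Adj-sym {u} {v} u-v = trans (Graph.sym G v u) u-v

  module _ {S : Subset n} {u v : Fin n} (u∈S : u ∈ S) (v∉S : v ∉ S)
           (u~v : Twins G u v) where

    private
      ∉⇒≢ : ∀ {w} → w ∉ S → w ≢ u
      ∉⇒≢ w∉S refl = w∉S u∈S

    Conn-twin-neighbour : ∀ {b} → Adj G u b → b ∉ S → Conn G S v b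
    Conn-twin-neighbour {b} u-b b∉S with b ≟ v
    ... | yes refl = here v∉S
    ... | no b≢v   = step v∉S (proj₁ (u~v b (∉⇒≢ b∉S) b≢v) u-b) (here b∉S)

    Conn-neighbours : ∀ {a b} → Adj G u a → a ∉ S → Adj G u b → b ∉ S →
                      Conn G S a b
    Conn-neighbours {a} u-a a∉S u-b b∉S with a ≟ v
    ... | yes refl = Conn-twin-neighbour u-b b∉S
    ... | no a≢v   = step a∉S (Adj-sym (proj₁ (u~v a (∉⇒≢ a∉S) a≢v) u-a))
                              (Conn-twin-neighbour u-b b∉S)

    Redundant-twin-outside : Redundant G S u
    Redundant-twin-outside = u∈S , λ _ _ → Conn-neighbours

  Irredundant-twin-closed : ∀ {S u v} → Irredundant G S → Twins G u v →
                            u ∈ S → v ∈ S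
  Irredundant-twin-closed {S} {v = v} irr u~v u∈S =
    decidable-stable (v ∈? S) λ v∉S →
      irr _ u∈S (Redundant-twin-outside u∈S v∉S u~v)

lemma2p4 : ∀ {n : ℕ} (G : Graph n) (S : Subset n) → Irredundant G S →
    ∀ (T : Subset n) → TwinClass G T → Empty (T ∩ S) ⊎ T ⊆ S
lemma2p4 G S irr T (twins , _) with any? (_∈? (T ∩ S))
... | no T∩S-empty = inj₁ T∩S-empty
... | yes (u , u∈T∩S) with x∈p∩q⁻ T S u∈T∩S
...   | u∈T , u∈S = inj₂ λ {v} v∈T →
          Irredundant-twin-closed G irr (twins u v u∈T v∈T) u∈S
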